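{- Let $T$ be a tree with $n\ge2$ vertices and let $u$ be a centroid of $T$. Then $|\mathcal{P}^{ -1}_T(u)|\ge n^2/4$.
   Context: A vertex $u$ of a tree $T$ is a centroid if it minimizes the maximum number of vertices of a connected component of $T-u$. For vertices $x,y$ of $T$, $\mathcal{P}_T(x,y)$ is the set of vertices on the unique simple $x$–$y$ path, including $x$ and $y$. $\mathcal{P}^{ -1}_T(w)=\{\{x,y\}\subseteq V(T): w\in\mathcal{P}_T(x,y)\}$ is the set of unordered pairs of distinct vertices whose path passes through $w$ (including pairs having $w$ as an endpoint). -}

module Defs where

open import Level using (0ℓ)
open import Data.Nat using (ℕ; _≤_; _*_)
open import Data.Fin using (Fin; _<_)
open import Data.List using (List; []; _∷_; length)
open import Data.List.Membership.Propositional using (_∈_; _∉_)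
open import Data.List.Relation.Unary.Unique.Propositional using (Unique)
open import Data.List.Relation.Unary.All using (All)
open import Data.Product using (Σ; ∃; _×_; _,_)
open import Relation.Binary.PropositionalEquality using (_≡_; _≢_)
open import Relation.Nullary using (¬_)

record Graph (n : ℕ) : Set₁ where
  field
    Adj     : Fin n → Fin n → Set
    symm    : ∀ {x y} → Adj x y → Adj y x
    irrefl  : ∀ {x} → ¬ Adj x x
open Graph public

module _ {n : ℕ} (G : Graph n) where

  data Walk : Fin n → Fin n → List (Fin n) → Set where
    here : ∀ {x} → Walk x x (x ∷ [])
    step : ∀ {x y z vs} → Adj G x y → Walk y z vs → Walk x z (x ∷ vs)

  SimplePath : Fin n → Fin n → List (Fin n) → Set
  SimplePath x y vs = Walk x y vs × Unique vs

  record IsTree : Set where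
    field
      connected : ∀ x y → ∃ λ vs → SimplePath x y vs
      uniquePath : ∀ {x y vs ws} → SimplePath x y vs → SimplePath x y ws → vs ≡ ws

  -- w ∈ 𝒫_T(x,y): w lies on the (unique) x–y path.
  OnPath : Fin n → Fin n → Fin n → Set
  OnPath x y w = ∃ λ vs → SimplePath x y vs × w ∈ vs

  -- w and v lie in the same connected component of G - u.
  ConnAvoid : Fin n → Fin n → Fin n → Set
  ConnAvoid u v w = ∃ λ vs → Walk v w vs × u ∉ vs

  -- Every connected component of G - u has at most k vertices.
  CompsAtMost : Fin n → ℕ → Set
  CompsAtMost u k = ∀ v → v ≢ u → (L : List (Fin n)) → Unique L →
                    All (ConnAvoid u v) L → length L ≤ k

  -- u is a centroid: the maximum component size of G - u is at most
  -- that of G - w, for every vertex w.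
  IsCentroid : Fin n → Set
  IsCentroid u = ∀ w k → CompsAtMost w k → CompsAtMost u k

module Submission where

-- Let u be a centroid and x ≠ u; let s be the size of the component of T − u containing x and v
-- the neighbour of u towards x.  A component of T − v either lies on u's side of v, hence among
-- the n − s vertices separated from x by u, or beyond v, hence in x's component minus v.  As u is
-- a centroid, s ≤ max (n − s) (s − 1), so s ≤ n − s: at least n/2 vertices y are separated from
-- x by u (and n − 1 ≥ n/2 when x = u).  Summing over x counts every pair through u twice.

open import Defs
open import Data.Nat using (ℕ; suc; _+_; _*_; _⊔_; pred; _≤_; z≤n; s≤s; s≤s⁻¹)
import Data.Nat.Properties as ℕₚ
open import Data.Fin using (Fin; _<_; _≟_; _<?_)
import Data.Fin.Properties as Fin
open import Data.List using (List; []; _∷_; _++_; length; map; filter; allFin)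
import Data.List.Properties as List
open import Data.List.Membership.Propositional using (_∈_; _∉_)
open import Data.List.Membership.Propositional.Properties
import Data.List.Membership.DecPropositional as DecMembership
open import Data.List.Relation.Binary.Subset.Propositional using (_⊆_)
open import Data.List.Relation.Binary.Subset.Propositional.Properties using (∷⁺ʳ; ∈-∷⁺ʳ)
open import Data.List.Relation.Unary.Any using (here; there)
open import Data.List.Relation.Unary.All using (All)
import Data.List.Relation.Unary.All as All
open import Data.List.Relation.Unary.All.Properties using (¬Any⇒All¬)
open import Data.List.Relation.Unary.AllPairs using (_∷_; [])
open import Data.List.Relation.Unary.Unique.Propositional using (Unique)
import Data.List.Relation.Unary.Unique.Propositional.Properties as Unique
open import Data.Product using (∃; _×_; _,_; proj₁; proj₂)
import Data.Product as Product
open import Data.Sum using (_⊎_; [_,_]′; inj₁; inj₂)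
open import Relation.Nullary using (¬_; Dec; yes; no; ¬?; contradiction)
open import Relation.Nullary.Decidable using (_×-dec_)
open import Relation.Unary using (Pred; Decidable)
open import Relation.Binary.PropositionalEquality using (_≡_; _≢_; refl; sym; trans; cong; subst)
open import Function using (_∘_; id)
open import Level using (0ℓ)

m≤n⊔pred-m⇒m≤n : ∀ {m n} → 1 ≤ m → m ≤ n ⊔ pred m → m ≤ n
m≤n⊔pred-m⇒m≤n {suc m} {n} _ m<n⊔m with ℕₚ.⊔-sel n m
... | inj₁ n⊔m≡n = subst (suc m ≤_) n⊔m≡n m<n⊔m
... | inj₂ n⊔m≡m = contradiction (subst (suc m ≤_) n⊔m≡m m<n⊔m) ℕₚ.1+n≰n

n≤1+m⇒n≤2*m : ∀ {m n} → 2 ≤ n → n ≤ suc m → n ≤ 2 * m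
n≤1+m⇒n≤2*m {m} {n} 2≤n n≤1+m = begin
  n          ≤⟨ n≤1+m ⟩
  suc m      ≡⟨ ℕₚ.+-comm 1 m ⟩
  m + 1      ≤⟨ ℕₚ.+-monoʳ-≤ m (s≤s⁻¹ (ℕₚ.≤-trans 2≤n n≤1+m)) ⟩
  m + m      ≡⟨ cong (m +_) (ℕₚ.+-identityʳ m) ⟨
  2 * m      ∎
  where open ℕₚ.≤-Reasoning

module _ {A : Set} where

  remove-∈ : ∀ {x : A} {ys} → x ∈ ys →
             ∃ λ zs → length ys ≡ suc (length zs) × (∀ {a} → a ∈ ys → a ≢ x → a ∈ zs)
  remove-∈ {ys = y ∷ ys} (here refl) = ys , refl , λ { (here refl) a≢x → contradiction refl a≢x
                                                     ; (there m) _ → m }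
  remove-∈ {ys = y ∷ ys} (there x∈ys) with remove-∈ x∈ys
  ... | zs , length≡ , ⊆zs = y ∷ zs , cong suc length≡ , λ { (here e) _ → here e
                                                          ; (there m) a≢x → there (⊆zs m a≢x) }

  ⊆-Unique⇒length≤ : ∀ {xs ys : List A} → Unique xs → xs ⊆ ys → length xs ≤ length ys
  ⊆-Unique⇒length≤ {[]} _ _ = z≤n
  ⊆-Unique⇒length≤ {x ∷ xs} (x∉xs ∷ uxs) xs⊆ys with remove-∈ (xs⊆ys (here refl))
  ... | zs , length≡ , ⊆zs = subst (suc (length xs) ≤_) (sym length≡)
        (s≤s (⊆-Unique⇒length≤ uxs (λ m → ⊆zs (xs⊆ys (there m)) (All.lookup x∉xs m ∘ sym))))

  length-filter+length-filter¬ : ∀ {P : Pred A 0ℓ} (P? : Decidable P) xs →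
                                 length (filter P? xs) + length (filter (¬? ∘ P?) xs) ≡ length xs
  length-filter+length-filter¬ P? [] = refl
  length-filter+length-filter¬ P? (x ∷ xs) with P? x
  ... | yes _ = cong suc (length-filter+length-filter¬ P? xs)
  ... | no _  = trans (ℕₚ.+-suc _ _) (cong suc (length-filter+length-filter¬ P? xs))

module _ {n} {P : Pred (Fin n) 0ℓ} (P? : Decidable P) where

  filter-allFin-Unique : Unique (filter P? (allFin n))
  filter-allFin-Unique = Unique.filter⁺ P? (Unique.allFin⁺ n)

  ∈-filter-allFin⁺ : ∀ {y} → P y → y ∈ filter P? (allFin n)
  ∈-filter-allFin⁺ {y} = ∈-filter⁺ P? (∈-allFin y)

  ∈-filter-allFin⁻ : ∀ {y} → y ∈ filter P? (allFin n) → P y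
  ∈-filter-allFin⁻ m = proj₂ (∈-filter⁻ P? {xs = allFin n} m)

length-allFin : ∀ n → length (allFin n) ≡ n
length-allFin n = List.length-tabulate id

_∈?_ : ∀ {n} (x : Fin n) xs → Dec (x ∈ xs)
x ∈? xs = DecMembership._∈?_ _≟_ x xs

module _ {A B : Set} where

  pairs : (A → List B) → List A → List (A × B)
  pairs f [] = []
  pairs f (x ∷ xs) = map (x ,_) (f x) ++ pairs f xs

  ∈-pairs⁻ : ∀ {f : A → List B} xs {a b} → (a , b) ∈ pairs f xs → a ∈ xs × b ∈ f a
  ∈-pairs⁻ {f} (x ∷ xs) m with ∈-++⁻ (map (x ,_) (f x)) m
  ... | inj₂ m′ = Product.map₁ there (∈-pairs⁻ xs m′)
  ... | inj₁ m′ with ∈-map⁻ (x ,_) m′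
  ...   | _ , b∈fx , refl = here refl , b∈fx

  ∈-pairs⁺ : ∀ {f : A → List B} {xs a b} → a ∈ xs → b ∈ f a → (a , b) ∈ pairs f xs
  ∈-pairs⁺ {f} {x ∷ xs} (here refl) b∈fa = ∈-++⁺ˡ (∈-map⁺ (x ,_) b∈fa)
  ∈-pairs⁺ {f} {x ∷ xs} (there a∈xs) b∈fa = ∈-++⁺ʳ (map (x ,_) (f x)) (∈-pairs⁺ a∈xs b∈fa)

  pairs-Unique : ∀ {f : A → List B} {xs} → (∀ x → Unique (f x)) → Unique xs → Unique (pairs f xs)
  pairs-Unique {f} {[]} _ _ = []
  pairs-Unique {f} {x ∷ xs} uf (x∉xs ∷ uxs) =
    Unique.++⁺ (Unique.map⁺ (cong proj₂) (uf x)) (pairs-Unique uf uxs) disjoint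
    where
    disjoint : ∀ {p} → ¬ (p ∈ map (x ,_) (f x) × p ∈ pairs f xs)
    disjoint (m₁ , m₂) with ∈-map⁻ (x ,_) m₁
    ... | _ , _ , refl = All.lookup x∉xs (proj₁ (∈-pairs⁻ xs m₂)) refl

  length-pairs-≥ : ∀ {f : A → List B} {m k} → (∀ x → m ≤ k * length (f x)) →
                   ∀ xs → length xs * m ≤ k * length (pairs f xs)
  length-pairs-≥ bound [] = z≤n
  length-pairs-≥ {f} {m} {k} bound (x ∷ xs) = begin
    m + length xs * m
      ≤⟨ ℕₚ.+-mono-≤ (bound x) (length-pairs-≥ {f} {m} {k} bound xs) ⟩
    k * length (f x) + k * length (pairs f xs)
      ≡⟨ ℕₚ.*-distribˡ-+ k _ _ ⟨
    k * (length (f x) + length (pairs f xs))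
      ≡⟨ cong (λ l → k * (l + length (pairs f xs))) (List.length-map (x ,_) (f x)) ⟨
    k * (length (map (x ,_) (f x)) + length (pairs f xs))
      ≡⟨ cong (k *_) (List.length-++ (map (x ,_) (f x))) ⟨
    k * length (pairs f (x ∷ xs))
      ∎
    where open ℕₚ.≤-Reasoning

module _ {n : ℕ} where

  Ascending : Pred (Fin n × Fin n) 0ℓ
  Ascending p = proj₁ p < proj₂ p

  ascending? : Decidable Ascending
  ascending? p = proj₁ p <? proj₂ p

  length≤2*length-ascending : ∀ {ps : List (Fin n × Fin n)} → Unique ps →
                              (∀ {x y} → (x , y) ∈ ps → x ≢ y × (y , x) ∈ ps) →
                              length ps ≤ 2 * length (filter ascending? ps)
  length≤2*length-ascending {ps} ups symmetric = begin
    length ps                ≡⟨ length-filter+length-filter¬ ascending? ps ⟨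
    length asc + length desc ≤⟨ ℕₚ.+-monoʳ-≤ (length asc) desc≤asc ⟩
    length asc + length asc  ≡⟨ cong (length asc +_) (ℕₚ.+-identityʳ (length asc)) ⟨
    2 * length asc           ∎
    where
    open ℕₚ.≤-Reasoning
    asc desc : List (Fin n × Fin n)
    asc = filter ascending? ps
    desc = filter (¬? ∘ ascending?) ps

    swap-desc⊆asc : map Product.swap desc ⊆ asc
    swap-desc⊆asc m with ∈-map⁻ Product.swap m
    ... | (a , b) , ab∈desc , refl with ∈-filter⁻ (¬? ∘ ascending?) {xs = ps} ab∈desc
    ...   | ab∈ps , a≮b with symmetric ab∈ps
    ...     | a≢b , ba∈ps = ∈-filter⁺ ascending? ba∈ps (Fin.≤∧≢⇒< (ℕₚ.≮⇒≥ a≮b) (a≢b ∘ sym))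

    desc≤asc : length desc ≤ length asc
    desc≤asc = subst (_≤ length asc) (List.length-map Product.swap desc) (⊆-Unique⇒length≤
      (Unique.map⁺ swap-injective (Unique.filter⁺ (¬? ∘ ascending?) ups)) swap-desc⊆asc)
      where
      swap-injective : ∀ {p q : Fin n × Fin n} → Product.swap p ≡ Product.swap q → p ≡ q
      swap-injective refl = refl

module WalkProperties {n : ℕ} (G : Graph n) where

  start∈ : ∀ {x y vs} → Walk G x y vs → x ∈ vs
  start∈ here       = here refl
  start∈ (step _ _) = here refl

  end∈ : ∀ {x y vs} → Walk G x y vs → y ∈ vs
  end∈ here       = here refl
  end∈ (step _ p) = there (end∈ p)

  concat-walk : ∀ {x y z vs ws} → Walk G x y vs → Walk G y z ws →
                ∃ λ l → Walk G x z l × l ⊆ vs ++ ws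
  concat-walk here q = _ , q , there
  concat-walk (step a p) q with concat-walk p q
  ... | l , pq , l⊆ = _ , step a pq , ∷⁺ʳ _ l⊆

  snoc-walk : ∀ {x y z vs} → Walk G x y vs → Adj G y z → Walk G x z (vs ++ z ∷ [])
  snoc-walk here       a = step a here
  snoc-walk (step b p) a = step b (snoc-walk p a)

  reverse-walk : ∀ {x y vs} → Walk G x y vs → ∃ λ l → Walk G y x l × l ⊆ vs
  reverse-walk here = _ , here , id
  reverse-walk {x} {vs = x ∷ vs} (step a p) with reverse-walk p
  ... | l , q , l⊆vs = l ++ x ∷ [] , snoc-walk q (symm G a) ,
        [ there ∘ l⊆vs , (λ { (here refl) → here refl }) ]′ ∘ ∈-++⁻ l

  prefix-walk : ∀ {x y c vs} → Walk G x y vs → c ∈ vs → ∃ λ l → Walk G x c l × l ⊆ vs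
  prefix-walk here       (here refl) = _ , here , id
  prefix-walk (step a p) (here refl) = _ , here , λ { (here refl) → here refl }
  prefix-walk (step a p) (there c∈vs) with prefix-walk p c∈vs
  ... | l , q , l⊆vs = _ , step a q , ∷⁺ʳ _ l⊆vs

  suffix-walk : ∀ {x y c vs} → Walk G x y vs → c ∈ vs →
                ∃ λ l → Walk G c y l × l ⊆ vs × (Unique vs → Unique l)
  suffix-walk here       (here refl) = _ , here , id , id
  suffix-walk (step a p) (here refl) = _ , step a p , id , id
  suffix-walk (step a p) (there c∈vs) with suffix-walk p c∈vs
  ... | l , q , l⊆vs , unique = l , q , there ∘ l⊆vs , λ { (_ ∷ uvs) → unique uvs }

  shorten-walk : ∀ {x y vs} → Walk G x y vs → ∃ λ l → SimplePath G x y l × l ⊆ vs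
  shorten-walk here = _ , (here , All.[] ∷ []) , id
  shorten-walk {x} (step a p) with shorten-walk p
  ... | l , (q , ul) , l⊆vs with x ∈? l
  ...   | yes x∈l = let l′ , q′ , l′⊆l , unique = suffix-walk q x∈l
                    in l′ , (q′ , unique ul) , there ∘ l⊆vs ∘ l′⊆l
  ...   | no x∉l  = x ∷ l , (step a q , ¬Any⇒All¬ l x∉l ∷ ul) , ∷⁺ʳ x l⊆vs

  ConnAvoid⇒≢ : ∀ {u x y} → ConnAvoid G u x y → u ≢ y
  ConnAvoid⇒≢ (_ , p , u∉vs) refl = u∉vs (end∈ p)

  ConnAvoid-trans : ∀ {u x y z} → ConnAvoid G u x y → ConnAvoid G u y z → ConnAvoid G u x z
  ConnAvoid-trans (vs , p , u∉vs) (ws , q , u∉ws) with concat-walk p q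
  ... | l , pq , l⊆ = l , pq , [ u∉vs , u∉ws ]′ ∘ ∈-++⁻ vs ∘ l⊆

  ConnAvoid-sym : ∀ {u x y} → ConnAvoid G u x y → ConnAvoid G u y x
  ConnAvoid-sym (vs , p , u∉vs) with reverse-walk p
  ... | l , q , l⊆vs = l , q , u∉vs ∘ l⊆vs

  ConnAvoid⇒SimplePath : ∀ {u x y} → ConnAvoid G u x y → ∃ λ l → SimplePath G x y l × u ∉ l
  ConnAvoid⇒SimplePath (vs , p , u∉vs) with shorten-walk p
  ... | l , sp , l⊆vs = l , sp , u∉vs ∘ l⊆vs

  SimplePath⇒first-step : ∀ {u x vs} → SimplePath G u x vs → x ≢ u →
                          ∃ λ v → Adj G u v × ConnAvoid G u v x
  SimplePath⇒first-step (here , _)       x≢u = contradiction refl x≢u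
  SimplePath⇒first-step (step a p , uvs) _   = _ , a , _ , p , Unique.Unique[x∷xs]⇒x∉xs uvs

  SimplePath⇒ConnAvoid : ∀ {a b c vs} → SimplePath G a b vs → c ∈ vs → c ≢ a → ConnAvoid G a c b
  SimplePath⇒ConnAvoid (here , _)            (here refl) c≢a = contradiction refl c≢a
  SimplePath⇒ConnAvoid (step _ _ , _)        (here refl) c≢a = contradiction refl c≢a
  SimplePath⇒ConnAvoid (step _ p , a∉vs ∷ _) (there c∈vs) _ with suffix-walk p c∈vs
  ... | l , q , l⊆vs , _ = l , q , (λ a∈vs → All.lookup a∉vs a∈vs refl) ∘ l⊆vs

  ConnAvoid-avoid-or-reach : ∀ {u v w z} → ConnAvoid G v w z → ConnAvoid G u w z ⊎ ConnAvoid G v w u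
  ConnAvoid-avoid-or-reach {u} (vs , p , v∉vs) with u ∈? vs
  ... | no u∉vs  = inj₁ (vs , p , u∉vs)
  ... | yes u∈vs = let l , q , l⊆vs = prefix-walk p u∈vs in inj₂ (l , q , v∉vs ∘ l⊆vs)

module TreeProperties {n : ℕ} (T : Graph n) (tree : IsTree T) where
  open WalkProperties T public
  open IsTree tree

  path : Fin n → Fin n → List (Fin n)
  path x y = proj₁ (connected x y)

  path-simple : ∀ x y → SimplePath T x y (path x y)
  path-simple x y = proj₂ (connected x y)

  ∈path? : ∀ u x y → Dec (u ∈ path x y)
  ∈path? u x y = u ∈? path x y

  ∉path⇒ConnAvoid : ∀ {u x y} → u ∉ path x y → ConnAvoid T u x y
  ∉path⇒ConnAvoid {x = x} {y} u∉ = path x y , proj₁ (path-simple x y) , u∉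

  ConnAvoid⇒∉path : ∀ {u x y} → ConnAvoid T u x y → u ∉ path x y
  ConnAvoid⇒∉path {u} {x} {y} c with ConnAvoid⇒SimplePath c
  ... | l , sp , u∉l = subst (u ∉_) (uniquePath sp (path-simple x y)) u∉l

  path-refl : ∀ x → path x x ≡ x ∷ []
  path-refl x = uniquePath (path-simple x x) (here , All.[] ∷ [])

  ∈path-sym : ∀ {u x y} → u ∈ path x y → u ∈ path y x
  ∈path-sym {u} {x} {y} u∈ with ∈path? u y x
  ... | yes u∈′ = u∈′
  ... | no u∉   = contradiction u∈ (ConnAvoid⇒∉path (ConnAvoid-sym (∉path⇒ConnAvoid u∉)))

  ∈path⇒ConnAvoid : ∀ {a b c} → c ∈ path a b → c ≢ a → ConnAvoid T a c b
  ∈path⇒ConnAvoid = SimplePath⇒ConnAvoid (path-simple _ _)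

  edge-bridge : ∀ {u v z} → Adj T v u → ConnAvoid T v z u → ¬ ConnAvoid T u z v
  edge-bridge {u} {v} vu c₁ c₂ with ConnAvoid⇒SimplePath c₁ | ConnAvoid⇒SimplePath c₂
  ... | l₁ , sp₁ , v∉l₁ | l₂ , (p₂ , ul₂) , u∉l₂ = v∉l₁ (subst (v ∈_) (sym l₁≡) (∈-++⁺ˡ (end∈ p₂)))
    where
    l₁≡ : l₁ ≡ l₂ ++ u ∷ []
    l₁≡ = uniquePath sp₁ (snoc-walk p₂ vu ,
                          Unique.++⁺ ul₂ (All.[] ∷ []) λ { (u∈l₂ , here refl) → u∉l₂ u∈l₂ })

module Branches {n : ℕ} (T : Graph n) (tree : IsTree T) (u : Fin n) where
  open TreeProperties T tree public

  -- For x ≢ u, side x is the vertex set of the component of T − u containing x.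
  across side : Fin n → List (Fin n)
  across x = filter (∈path? u x) (allFin n)
  side x = filter (¬? ∘ ∈path? u x) (allFin n)

  length-across+side : ∀ x → length (across x) + length (side x) ≡ n
  length-across+side x =
    trans (length-filter+length-filter¬ (∈path? u x) (allFin n)) (length-allFin n)

  ConnAvoid⇒∈side : ∀ {x y} → ConnAvoid T u x y → y ∈ side x
  ConnAvoid⇒∈side c = ∈-filter-allFin⁺ (¬? ∘ ∈path? u _) (ConnAvoid⇒∉path c)

  ∈side⇒ConnAvoid : ∀ {x y} → y ∈ side x → ConnAvoid T u x y
  ∈side⇒ConnAvoid m = ∉path⇒ConnAvoid (∈-filter-allFin⁻ (¬? ∘ ∈path? u _) m)

  length-side≤ : ∀ {x k} → CompsAtMost T u k → x ≢ u → length (side x) ≤ k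
  length-side≤ {x} comps x≢u =
    comps x x≢u (side x) (filter-allFin-Unique (¬? ∘ ∈path? u x)) (All.tabulate ∈side⇒ConnAvoid)

  module _ {v x} (uv : Adj T u v) (vx : ConnAvoid T u v x) where

    v≢u : v ≢ u
    v≢u refl = irrefl T uv

    near-component⊆across : ∀ {w z} → v ∉ path u w → ConnAvoid T v w z → z ∈ across x
    near-component⊆across {w} {z} v∉uw wz with ∈path? u x z
    ... | yes u∈xz = ∈-filter-allFin⁺ (∈path? u x) u∈xz
    ... | no u∉xz  = contradiction u-zv (edge-bridge (symm T uv) v-zu)
      where
      v-zu : ConnAvoid T v z u
      v-zu = ConnAvoid-sym (ConnAvoid-trans (∉path⇒ConnAvoid v∉uw) wz)
      u-zv : ConnAvoid T u z v
      u-zv = ConnAvoid-sym (ConnAvoid-trans vx (∉path⇒ConnAvoid u∉xz))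

    far-component⊆side : ∀ {w z} → v ∈ path u w → ConnAvoid T v w z → z ∈ side x
    far-component⊆side v∈uw wz with ConnAvoid-avoid-or-reach wz
    ... | inj₁ u-wz =
      ConnAvoid⇒∈side (ConnAvoid-trans (ConnAvoid-sym vx) (ConnAvoid-trans (∈path⇒ConnAvoid v∈uw v≢u) u-wz))
    ... | inj₂ v-wu =
      contradiction (ConnAvoid-sym (∈path⇒ConnAvoid v∈uw v≢u)) (edge-bridge (symm T uv) v-wu)

    neighbour-components : CompsAtMost T v (length (across x) ⊔ pred (length (side x)))
    neighbour-components w _ L uL inL with ∈path? v u w
    ... | no v∉uw =
      ℕₚ.m≤n⇒m≤n⊔o _ (⊆-Unique⇒length≤ uL (near-component⊆across v∉uw ∘ All.lookup inL))
    ... | yes v∈uw = ℕₚ.m≤n⇒m≤o⊔n _ (ℕₚ.<⇒≤pred (⊆-Unique⇒length≤ (v∉L ∷ uL) v∷L⊆side))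
      where
      v∉L : All (v ≢_) L
      v∉L = All.map ConnAvoid⇒≢ inL
      v∷L⊆side : v ∷ L ⊆ side x
      v∷L⊆side =
        ∈-∷⁺ʳ (ConnAvoid⇒∈side (ConnAvoid-sym vx)) (far-component⊆side v∈uw ∘ All.lookup inL)

  centroid⇒side≤across : IsCentroid T u → ∀ {x} → x ≢ u → length (side x) ≤ length (across x)
  centroid⇒side≤across centroid {x} x≢u with SimplePath⇒first-step (path-simple u x) x≢u
  ... | v , uv , vx = m≤n⊔pred-m⇒m≤n (∈-length x∈side)
                        (length-side≤ (centroid v _ (neighbour-components uv vx)) x≢u)
    where
    x∈side : x ∈ side x
    x∈side = ConnAvoid⇒∈side (x ∷ [] , here , λ { (here u≡x) → x≢u (sym u≡x) })

module PairsThrough {n : ℕ} (T : Graph n) (tree : IsTree T) (u : Fin n) where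
  open Branches T tree u public

  Through : Fin n → Pred (Fin n) 0ℓ
  Through x y = x ≢ y × u ∈ path x y

  through? : ∀ x → Decidable (Through x)
  through? x y = ¬? (x ≟ y) ×-dec ∈path? u x y

  through : Fin n → List (Fin n)
  through x = filter (through? x) (allFin n)

  n≤2*length-through-centre : 2 ≤ n → n ≤ 2 * length (through u)
  n≤2*length-through-centre 2≤n = n≤1+m⇒n≤2*m 2≤n
    (subst (_≤ suc (length (through u))) (length-allFin n)
      (⊆-Unique⇒length≤ (Unique.allFin⁺ n) all⊆u∷through))
    where
    all⊆u∷through : allFin n ⊆ u ∷ through u
    all⊆u∷through {y} _ with u ≟ y
    ... | yes refl = here refl
    ... | no u≢y   = there (∈-filter-allFin⁺ (through? u) (u≢y , start∈ (proj₁ (path-simple u y))))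

  n≤2*length-through-branch : IsCentroid T u → ∀ {x} → x ≢ u → n ≤ 2 * length (through x)
  n≤2*length-through-branch centroid {x} x≢u = begin
    n                                      ≡⟨ length-across+side x ⟨
    length (across x) + length (side x)    ≤⟨ ℕₚ.+-monoʳ-≤ _ (centroid⇒side≤across centroid x≢u) ⟩
    length (across x) + length (across x)  ≡⟨ cong (length (across x) +_) (ℕₚ.+-identityʳ _) ⟨
    2 * length (across x)                  ≤⟨ ℕₚ.*-monoʳ-≤ 2 (⊆-Unique⇒length≤
                                                (filter-allFin-Unique (∈path? u x)) across⊆through) ⟩
    2 * length (through x)                 ∎
    where
    open ℕₚ.≤-Reasoning
    across⊆through : across x ⊆ through x
    across⊆through {y} m = ∈-filter-allFin⁺ (through? x) (x≢y , u∈xy)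
      where
      u∈xy = ∈-filter-allFin⁻ (∈path? u x) m
      x≢y : x ≢ y
      x≢y refl with subst (u ∈_) (path-refl x) u∈xy
      ... | here u≡x = x≢u (sym u≡x)

  centroid⇒n≤2*length-through : 2 ≤ n → IsCentroid T u → ∀ x → n ≤ 2 * length (through x)
  centroid⇒n≤2*length-through 2≤n centroid x with x ≟ u
  ... | yes refl = n≤2*length-through-centre 2≤n
  ... | no x≢u   = n≤2*length-through-branch centroid x≢u

  throughPairs : List (Fin n × Fin n)
  throughPairs = pairs through (allFin n)

  throughPairs-Unique : Unique throughPairs
  throughPairs-Unique = pairs-Unique (filter-allFin-Unique ∘ through?) (Unique.allFin⁺ n)

  ∈throughPairs⇒Through : ∀ {x y} → (x , y) ∈ throughPairs → Through x y
  ∈throughPairs⇒Through m = ∈-filter-allFin⁻ (through? _) (proj₂ (∈-pairs⁻ (allFin n) m))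

  throughPairs-symmetric : ∀ {x y} → (x , y) ∈ throughPairs → x ≢ y × (y , x) ∈ throughPairs
  throughPairs-symmetric {x} {y} m =
    x≢y , ∈-pairs⁺ (∈-allFin y) (∈-filter-allFin⁺ (through? y) (y≢x , u∈yx))
    where
    x≢y = proj₁ (∈throughPairs⇒Through m)
    y≢x = x≢y ∘ sym
    u∈yx = ∈path-sym (proj₂ (∈throughPairs⇒Through m))

  centroid⇒n*n≤2*length-throughPairs : 2 ≤ n → IsCentroid T u → n * n ≤ 2 * length throughPairs
  centroid⇒n*n≤2*length-throughPairs 2≤n centroid =
    subst (λ m → m * n ≤ 2 * length throughPairs) (length-allFin n)
      (length-pairs-≥ {f = through} {k = 2} (centroid⇒n≤2*length-through 2≤n centroid) (allFin n))

lemma6 : (n : ℕ) → 2 ≤ n → (T : Graph n) → IsTree T → (u : Fin n) → IsCentroid T u →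
         ∃ λ (L : List (Fin n × Fin n)) →
           Unique L × All (λ { (x , y) → x < y × OnPath T x y u }) L × n * n ≤ 4 * length L
lemma6 n 2≤n T tree u centroid =
  L , Unique.filter⁺ ascending? throughPairs-Unique , All.tabulate ascending-through , bound
  where
  open PairsThrough T tree u
  L : List (Fin n × Fin n)
  L = filter ascending? throughPairs

  ascending-through : ∀ {p} → p ∈ L → proj₁ p < proj₂ p × OnPath T (proj₁ p) (proj₂ p) u
  ascending-through {x , y} m with ∈-filter⁻ ascending? {xs = throughPairs} m
  ... | m′ , x<y = x<y , path x y , path-simple x y , proj₂ (∈throughPairs⇒Through m′)

  bound : n * n ≤ 4 * length L
  bound = begin
    n * n                  ≤⟨ centroid⇒n*n≤2*length-throughPairs 2≤n centroid ⟩
    2 * length throughPairs ≤⟨ ℕₚ.*-monoʳ-≤ 2 (length≤2*length-ascending throughPairs-Unique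
                                                                        throughPairs-symmetric) ⟩
    2 * (2 * length L)     ≡⟨ ℕₚ.*-assoc 2 2 (length L) ⟨
    4 * length L           ∎
    where open ℕₚ.≤-Reasoning
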